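{- Let $G$ be an additive subgroup of a finite field $\mathbb{F}_q$ and let $T(x)=ax+b$, with $a,b\in\mathbb{F}_q$, be a bijection of $G$ (i.e. $T(G)=G$). Then $b\in G$ and $a\in\mathbb{F}_{q'}$, where $\mathbb{F}_{q'}$ is the largest subfield of $\mathbb{F}_q$ such that $G$ is an $\mathbb{F}_{q'}$-vector subspace of $\mathbb{F}_q$. -}

module Defs where

open import Level using (0ℓ)
open import Data.Nat using (ℕ)
open import Data.Fin using (Fin)
open import Data.Product using (_×_; ∃)
open import Relation.Nullary using (¬_)
open import Relation.Unary using (Pred; _∈_; _⊆_)
open import Relation.Binary.PropositionalEquality using (_≡_; _≢_)
open import Algebra.Core using (Op₁; Op₂)
open import Algebra.Structures using (IsCommutativeRing)
open import Function.Bundles using (_↔_)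

record FiniteField : Set₁ where
  infixl 7 _*_
  infixl 6 _+_
  field
    Carrier           : Set
    _+_ _*_           : Op₂ Carrier
    -_                : Op₁ Carrier
    0# 1#             : Carrier
    isCommutativeRing : IsCommutativeRing _≡_ _+_ _*_ -_ 0# 1#
    0≢1               : 0# ≢ 1#
    inverse           : ∀ x → x ≢ 0# → ∃ λ y → x * y ≡ 1#
    size              : ℕ
    enumeration       : Fin size ↔ Carrier

module _ (F : FiniteField) where
  open FiniteField F

  record IsAdditiveSubgroup (G : Pred Carrier 0ℓ) : Set where
    field
      0∈ : 0# ∈ G
      +∈ : ∀ {x y} → x ∈ G → y ∈ G → (x + y) ∈ G
      -∈ : ∀ {x} → x ∈ G → (- x) ∈ G

  record IsSubfield (K : Pred Carrier 0ℓ) : Set where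
    field
      0∈   : 0# ∈ K
      1∈   : 1# ∈ K
      +∈   : ∀ {x y} → x ∈ K → y ∈ K → (x + y) ∈ K
      -∈   : ∀ {x} → x ∈ K → (- x) ∈ K
      *∈   : ∀ {x y} → x ∈ K → y ∈ K → (x * y) ∈ K
      inv∈ : ∀ {x y} → x ∈ K → x * y ≡ 1# → y ∈ K

  record IsSubspaceOver (K G : Pred Carrier 0ℓ) : Set where
    field
      subgroup : IsAdditiveSubgroup G
      scalar∈  : ∀ {c x} → c ∈ K → x ∈ G → (c * x) ∈ G

  record IsLargestSubfieldFor (G K : Pred Carrier 0ℓ) : Set₁ where
    field
      subfield : IsSubfield K
      subspace : IsSubspaceOver K G
      largest  : ∀ (K′ : Pred Carrier 0ℓ) → IsSubfield K′ → IsSubspaceOver K′ G → K′ ⊆ K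

  record IsAffineBijectionOf (G : Pred Carrier 0ℓ) (a b : Carrier) : Set where
    field
      maps-into  : ∀ {x} → x ∈ G → (a * x + b) ∈ G
      onto       : ∀ {y} → y ∈ G → ∃ λ x → x ∈ G × a * x + b ≡ y
      injective  : ∀ {x y} → x ∈ G → y ∈ G → a * x + b ≡ a * y + b → x ≡ y

-- The multipliers of G, the c with c G ⊆ G, form a subfield: closure under
-- sums, products and negation is immediate, and in a finite field the inverse
-- of c is a power of c. G is a vector space over this subfield, so it lies
-- inside the largest such subfield. If T maps G into G then b = T 0 ∈ G, and
-- then a x = T x − b ∈ G for every x ∈ G, so a is a multiplier of G.
module Submission where

open import Defs
open import Level using (0ℓ)
open import Data.Nat as ℕ using (ℕ; zero; suc)
open import Data.Nat.Properties using (n<1+n; m≤n⇒∃[o]m+o≡n; +-suc)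
open import Data.Fin using (Fin; toℕ)
open import Data.Fin.Properties using (pigeonhole)
open import Data.Product using (_×_; _,_; ∃; ∃₂)
open import Function using (_∘_)
open import Function.Bundles using (_↔_; Inverse; Injection)
open import Function.Properties.Inverse using (↔-sym; ↔⇒↣)
open import Relation.Unary using (Pred; _∈_; _⊆_)
open import Relation.Binary.PropositionalEquality
open import Algebra.Bundles using (CommutativeRing)
import Algebra.Properties.Ring as RingProperties
import Algebra.Properties.Semiring.Exp as Exp

sequence-repeats : ∀ {a n} {A : Set a} → Fin n ↔ A → (f : ℕ → A) →
                   ∃₂ λ i j → i ℕ.< j × f i ≡ f j
sequence-repeats {n = n} Fin↔A f
  with i , j , i<j , fi≡fj ← pigeonhole (n<1+n n) (Inverse.from Fin↔A ∘ f ∘ toℕ)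
  = toℕ i , toℕ j , i<j , Injection.injective (↔⇒↣ (↔-sym Fin↔A)) fi≡fj

module _ (F : FiniteField) where
  open FiniteField F

  commutativeRing : CommutativeRing 0ℓ 0ℓ
  commutativeRing = record { isCommutativeRing = isCommutativeRing }

  open CommutativeRing commutativeRing
    using (*-assoc; *-comm; *-identityˡ; *-identityʳ; zeroˡ; zeroʳ; distribʳ;
           +-assoc; +-identityˡ; +-identityʳ; -‿inverseʳ; semiring; ring)
  open RingProperties ring using (-‿distribˡ-*)
  open Exp semiring using (_^_; ^-homo-*)

  *-cancelˡ-unit : ∀ {c d x y} → d * c ≡ 1# → c * x ≡ c * y → x ≡ y
  *-cancelˡ-unit {c} {d} {x} {y} dc≡1 cx≡cy = begin
    x           ≡⟨ sym (*-identityˡ x) ⟩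
    1# * x      ≡⟨ cong (_* x) (sym dc≡1) ⟩
    d * c * x   ≡⟨ *-assoc d c x ⟩
    d * (c * x) ≡⟨ cong (d *_) cx≡cy ⟩
    d * (c * y) ≡⟨ sym (*-assoc d c y) ⟩
    d * c * y   ≡⟨ cong (_* y) dc≡1 ⟩
    1# * y      ≡⟨ *-identityˡ y ⟩
    y           ∎
    where open ≡-Reasoning

  ^-cancelˡ-unit : ∀ {c d x y} → d * c ≡ 1# → ∀ i → c ^ i * x ≡ c ^ i * y → x ≡ y
  ^-cancelˡ-unit _    zero    = *-cancelˡ-unit (*-identityˡ 1#)
  ^-cancelˡ-unit {c} {x = x} {y} dc≡1 (suc i) eq = ^-cancelˡ-unit dc≡1 i
    (*-cancelˡ-unit dc≡1 (trans (sym (*-assoc c _ x)) (trans eq (*-assoc c _ y))))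

  left-inverse≡right-inverse : ∀ {c d e} → d * c ≡ 1# → c * e ≡ 1# → d ≡ e
  left-inverse≡right-inverse {c} {d} {e} dc≡1 ce≡1 = begin
    d           ≡⟨ sym (*-identityʳ d) ⟩
    d * 1#      ≡⟨ cong (d *_) (sym ce≡1) ⟩
    d * (c * e) ≡⟨ sym (*-assoc d c e) ⟩
    d * c * e   ≡⟨ cong (_* e) dc≡1 ⟩
    1# * e      ≡⟨ *-identityˡ e ⟩
    e           ∎
    where open ≡-Reasoning

  -- By pigeonhole c ^ i ≡ c ^ (i + suc k) for some i and k; cancelling c ^ i
  -- leaves c * c ^ k ≡ 1#, so d ≡ c ^ k.
  inverse-is-power : ∀ {c d} → c * d ≡ 1# → ∃ λ k → d ≡ c ^ k
  inverse-is-power {c} {d} cd≡1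
    with i , j , i<j , ci≡cj ← sequence-repeats enumeration (c ^_)
    with k , refl ← m≤n⇒∃[o]m+o≡n i<j
    = k , left-inverse≡right-inverse dc≡1 (sym (^-cancelˡ-unit dc≡1 i ci*1≡ci*c^suc-k))
    where
    dc≡1 : d * c ≡ 1#
    dc≡1 = trans (*-comm d c) cd≡1
    ci*1≡ci*c^suc-k : c ^ i * 1# ≡ c ^ i * c ^ suc k
    ci*1≡ci*c^suc-k = begin
      c ^ i * 1#         ≡⟨ *-identityʳ _ ⟩
      c ^ i              ≡⟨ ci≡cj ⟩
      c ^ (suc i ℕ.+ k)  ≡⟨ cong (c ^_) (sym (+-suc i k)) ⟩
      c ^ (i ℕ.+ suc k)  ≡⟨ ^-homo-* c i (suc k) ⟩
      c ^ i * c ^ suc k  ∎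
      where open ≡-Reasoning

  Multiplier : Pred Carrier 0ℓ → Pred Carrier 0ℓ
  Multiplier G c = ∀ {x} → x ∈ G → c * x ∈ G

  module _ {G : Pred Carrier 0ℓ} (G-subgroup : IsAdditiveSubgroup F G) where
    open IsAdditiveSubgroup G-subgroup

    ^-multiplier : ∀ {c} → c ∈ Multiplier G → ∀ k → c ^ k ∈ Multiplier G
    ^-multiplier _   zero    {x} x∈G = subst G (sym (*-identityˡ x)) x∈G
    ^-multiplier {c} c∈M (suc k) {x} x∈G =
      subst G (sym (*-assoc c (c ^ k) x)) (c∈M (^-multiplier c∈M k x∈G))

    multiplier-isSubfield : IsSubfield F (Multiplier G)
    multiplier-isSubfield = record
      { 0∈   = λ {x} _ → subst G (sym (zeroˡ x)) 0∈
      ; 1∈   = λ {x} x∈G → subst G (sym (*-identityˡ x)) x∈G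
      ; +∈   = λ {c} {c′} c∈M c′∈M {x} x∈G →
                 subst G (sym (distribʳ x c c′)) (+∈ (c∈M x∈G) (c′∈M x∈G))
      ; -∈   = λ {c} c∈M {x} x∈G → subst G (-‿distribˡ-* c x) (-∈ (c∈M x∈G))
      ; *∈   = λ {c} {c′} c∈M c′∈M {x} x∈G → subst G (sym (*-assoc c c′ x)) (c∈M (c′∈M x∈G))
      ; inv∈ = λ c∈M cd≡1 {x} x∈G →
                 let k , d≡c^k = inverse-is-power cd≡1
                 in subst (λ d → d * x ∈ G) (sym d≡c^k) (^-multiplier c∈M k x∈G)
      }

    multiplier⊆largestSubfield : ∀ {K} → IsLargestSubfieldFor F G K → Multiplier G ⊆ K
    multiplier⊆largestSubfield K-largest = IsLargestSubfieldFor.largest K-largest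
      (Multiplier G) multiplier-isSubfield
      (record { subgroup = G-subgroup ; scalar∈ = λ c∈M → c∈M })

    affine-offset∈ : ∀ {a b} → (∀ {x} → x ∈ G → a * x + b ∈ G) → b ∈ G
    affine-offset∈ {a} {b} T[G]⊆G =
      subst G (trans (cong (_+ b) (zeroʳ a)) (+-identityˡ b)) (T[G]⊆G 0∈)

    affine-slope-multiplier : ∀ {a b} → (∀ {x} → x ∈ G → a * x + b ∈ G) → a ∈ Multiplier G
    affine-slope-multiplier {a} {b} T[G]⊆G {x} x∈G =
      subst G ax+b-b≡ax (+∈ (T[G]⊆G x∈G) (-∈ (affine-offset∈ T[G]⊆G)))
      where
      ax+b-b≡ax : a * x + b + - b ≡ a * x
      ax+b-b≡ax = trans (+-assoc _ b (- b)) (trans (cong (a * x +_) (-‿inverseʳ b)) (+-identityʳ _))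

proposition4 : (F : FiniteField) → (G : Pred (FiniteField.Carrier F) 0ℓ) → IsAdditiveSubgroup F G → (a b : FiniteField.Carrier F) → IsAffineBijectionOf F G a b
                 → b ∈ G × (∀ (K : Pred (FiniteField.Carrier F) 0ℓ) → IsLargestSubfieldFor F G K → a ∈ K)
proposition4 F G G-subgroup a b T =
    affine-offset∈ F G-subgroup maps-into
  , λ K K-largest → multiplier⊆largestSubfield F G-subgroup K-largest
                      (affine-slope-multiplier F G-subgroup maps-into)
  where open IsAffineBijectionOf T using (maps-into)
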